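{- For every $n\ge0$ and every permutation $\pi\in\mathfrak S_n$, $\widehat\phi(\pi)=\varphi(\pi)$.
   Context: $\mathfrak S_n$ is the symmetric group on $[n]$ in one-line notation; $\mathfrak S_0=\{\emptyset\}$. For $n\ge1$, $Y_n$ is the set of planar binary trees with $n$ internal nodes ($n+1$ leaves ordered left to right); $Y_0=\{\ast\}$, the trivial one-vertex tree. $T_1\vee T_2$ is the tree with a new root with left subtree $T_1$ and right subtree $T_2$. Let $t\in Y_1$ be the 2-corolla; for $T\in Y_p$ and $1\le i\le p+1$, $T\triangleleft_i t$ is the tree obtained by grafting $t$ onto the $i$-th leaf of $T$. $\mathrm{std}(a)$ is the standardization of a word $a$ of distinct integers ($\mathrm{std}(\emptyset)=\emptyset$). For a word $a$ and integer $x$, $a^{<x}$ (resp. $a^{>x}$) is the subsequence of entries of $a$ strictly less (resp. greater) than $x$, in the original order. Define $\widehat\phi:\mathfrak S_n\to Y_n$ by $\widehat\phi(\emptyset)=\ast$, $\widehat\phi(1)=t$, and $\widehat\phi(\pi)=\widehat\phi(\mathrm{std}(\pi_2\cdots\pi_n))\triangleleft_{\pi_1}t$ for $n>1$. Define $\varphi:\mathfrak S_n\to Y_n$ by $\varphi(\emptyset)=\ast$ and, for $n>0$, $\varphi(\pi)=\varphi(\mathrm{std}(\pi^{<\pi_n}))\vee\varphi(\mathrm{std}(\pi^{>\pi_n}))$ (an empty subsequence yields $\ast$). -}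

module Defs where

open import Data.Nat using (ℕ; zero; suc; _+_; _∸_; _<?_; _>?_; _≤?_)
open import Data.List using (List; []; _∷_; length; map; filter; upTo)
open import Relation.Nullary using (yes; no)
open import Relation.Binary.PropositionalEquality using (_≡_)
open import Data.List.Relation.Binary.Permutation.Propositional using (_↭_)

oneTo : ℕ → List ℕ
oneTo n = map suc (upTo n)

IsPerm : ℕ → List ℕ → Set
IsPerm n π = π ↭ oneTo n

-- Planar binary trees; `leaf` is the trivial one-vertex tree ∗,
-- `node l r` is l ∨ r.
data Tree : Set where
  leaf : Tree
  node : Tree → Tree → Tree

_∨_ : Tree → Tree → Tree
_∨_ = node

t : Tree
t = node leaf leaf

leaves : Tree → ℕ
leaves leaf = 1
leaves (node l r) = leaves l + leaves r

-- T ◁ i : graft t onto the i-th leaf (1-indexed, left to right) of T.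
-- (Out-of-range indices leave the tree unchanged; never used in the theorem.)
_◁_ : Tree → ℕ → Tree
leaf ◁ zero = leaf
leaf ◁ suc zero = t
leaf ◁ suc (suc _) = leaf
node l r ◁ i with i ≤? leaves l
... | yes _ = node (l ◁ i) r
... | no  _ = node l (r ◁ (i ∸ leaves l))

std : List ℕ → List ℕ
std w = map (λ x → suc (length (filter (λ y → y <? x) w))) w

lastOr0 : List ℕ → ℕ
lastOr0 [] = 0
lastOr0 (x ∷ []) = x
lastOr0 (_ ∷ y ∷ ys) = lastOr0 (y ∷ ys)

below above : ℕ → List ℕ → List ℕ
below x a = filter (λ y → y <? x) a
above x a = filter (λ y → y >? x) a

-- φ̂, defined by recursion with fuel (fuel = length of the word suffices,
-- since std preserves length).
φ̂-aux : ℕ → List ℕ → Tree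
φ̂-aux _ [] = leaf
φ̂-aux _ (_ ∷ []) = t
φ̂-aux zero (_ ∷ _ ∷ _) = leaf
φ̂-aux (suc k) (x ∷ y ∷ ys) = φ̂-aux k (std (y ∷ ys)) ◁ x

φ̂ : List ℕ → Tree
φ̂ π = φ̂-aux (length π) π

-- φ, by recursion with fuel (subsequences are strictly shorter).
φ-aux : ℕ → List ℕ → Tree
φ-aux _ [] = leaf
φ-aux zero (_ ∷ _) = leaf
φ-aux (suc k) π@(_ ∷ _) =
  φ-aux k (std (below (lastOr0 π) π)) ∨ φ-aux k (std (above (lastOr0 π) π))

φ : List ℕ → Tree
φ π = φ-aux (length π) π

{-# OPTIONS --safe #-}
-- The heart of the proof is an insertion law for φ on words of distinct letters:
-- φ (x ∷ w) is φ w with a corolla grafted onto leaf number rank w x = 1 + #{y ∈ w ∣ y < x}.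
-- Split w at its last letter p.  The new letter x joins w^{<p} if x < p and w^{>p}
-- otherwise, so by induction it is grafted at its rank inside that subword; as
-- φ (w^{<p}) has exactly rank w p leaves, this is leaf rank w x of φ w.  For this
-- induction the standardizations in the definition of φ are harmless, because φ only
-- sees the relative order of the letters.  Finally φ̂ is by definition iterated
-- insertion, so φ̂ (std w) = φ w for every word of distinct letters, and std π = π
-- for a permutation π.
module Submission where

open import Defs
open import Data.Nat using (ℕ; zero; suc; _+_; _<_; _≤_; _<?_; _>?_; _≤?_; _≟_; s≤s; z≤n)
open import Data.Nat.Properties
  using (<-irrefl; <-asym; <-trans; <-≤-trans; <-cmp; <⇒≤; ≤-refl; ≤-reflexive; ≤-trans; ≤-pred;
         ≤⇒≯; ≤∧≢⇒<; suc-injective; m+n∸m≡n; m+1+n≰m)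
open import Data.Nat.Induction using (<-wellFounded)
open import Data.List using (List; []; _∷_; [_]; _++_; length; map; filter; upTo)
open import Data.List.Properties
  using (length-map; length-++; length-filter; length-upTo; filter-accept; filter-reject; filter-all;
         filter-notAll; filter-++; map-∘; map-cong-local; map-id-local; upTo-∷ʳ; ++-identityʳ)
open import Data.List.Membership.Propositional using (_∈_; _∉_)
open import Data.List.Membership.Propositional.Properties using (∈-filter⁺; ∈-map⁻; ∈-upTo⁻)
open import Data.List.Relation.Binary.Subset.Propositional using (_⊆_)
open import Data.List.Relation.Binary.Subset.Propositional.Properties using (filter-⊆; xs⊆x∷xs)
open import Data.List.Relation.Unary.All as All using (All; []; _∷_)
open import Data.List.Relation.Unary.All.Properties using (all-filter)
open import Data.List.Relation.Unary.Any as Any using (here; there)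
open import Data.List.Relation.Unary.AllPairs using (_∷_)
open import Data.List.Relation.Unary.Unique.Propositional using (Unique)
open import Data.List.Relation.Unary.Unique.Propositional.Properties
  using (filter⁺; map⁺; upTo⁺; Unique[x∷xs]⇒x∉xs)
open import Data.List.Relation.Binary.Permutation.Propositional
  using (_↭_; ↭-refl; ↭-sym; ↭-trans; ↭-prep; ↭-swap; ↭⇒↭ₛ)
open import Data.List.Relation.Binary.Permutation.Propositional.Properties
  using (↭-length; filter-↭; shift; ++⁺ˡ; ∈-resp-↭)
import Data.List.Relation.Binary.Permutation.Setoid.Properties as SetoidPermutation
open import Data.Product using (_,_)
open import Function using (_∘_; _on_; _⇔_; mk⇔; Equivalence)
open import Induction.WellFounded using (WellFounded; WfRec)
import Induction.WellFounded as WF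
open import Level using (0ℓ)
open import Relation.Binary using (Rel; Tri; tri<; tri≈; tri>)
import Relation.Binary.Construct.On as On
open import Relation.Binary.PropositionalEquality
  using (_≡_; refl; sym; trans; cong; cong₂; subst; subst₂; setoid; module ≡-Reasoning)
open import Relation.Nullary using (yes; no; ¬_; contradiction)
open import Relation.Unary using (Pred; Decidable)
import Relation.Unary as U

open ≡-Reasoning
open SetoidPermutation (setoid ℕ) using (Unique-resp-↭)

private
  variable
    A B : Set
    k l x y z : ℕ
    v w : List ℕ
    f : ℕ → ℕ

filter-map-local : {P : Pred A 0ℓ} {Q : Pred B 0ℓ} (P? : Decidable P) (Q? : Decidable Q)
                   {g : A → B} {xs : List A} →
                   All (λ a → Q (g a) ⇔ P a) xs → filter Q? (map g xs) ≡ map g (filter P? xs)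
filter-map-local P? Q? [] = refl
filter-map-local P? Q? {g} {a ∷ _} (Qga⇔Pa ∷ rest) with P? a
... | yes Pa = trans (filter-accept Q? (Equivalence.from Qga⇔Pa Pa))
                     (cong (g a ∷_) (filter-map-local P? Q? rest))
... | no ¬Pa = trans (filter-reject Q? (¬Pa ∘ Equivalence.to Qga⇔Pa))
                     (filter-map-local P? Q? rest)

filter-filter-⊆ : {P Q : Pred A 0ℓ} (P? : Decidable P) (Q? : Decidable Q) → P U.⊆ Q →
                  ∀ xs → filter P? (filter Q? xs) ≡ filter P? xs
filter-filter-⊆ P? Q? P⊆Q [] = refl
filter-filter-⊆ P? Q? P⊆Q (a ∷ xs) with Q? a
... | no ¬Qa = trans (filter-filter-⊆ P? Q? P⊆Q xs) (sym (filter-reject P? (¬Qa ∘ P⊆Q)))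
... | yes _ with P? a
...   | yes _ = cong (a ∷_) (filter-filter-⊆ P? Q? P⊆Q xs)
...   | no _  = filter-filter-⊆ P? Q? P⊆Q xs

below-∷-< : y < l → below l (y ∷ w) ≡ y ∷ below l w
below-∷-< = filter-accept (_<? _)

below-∷-≮ : ¬ y < l → below l (y ∷ w) ≡ below l w
below-∷-≮ = filter-reject (_<? _)

above-∷-> : l < y → above l (y ∷ w) ≡ y ∷ above l w
above-∷-> = filter-accept (_>? _)

above-∷-≯ : ¬ l < y → above l (y ∷ w) ≡ above l w
above-∷-≯ = filter-reject (_>? _)

StrictMonoOn : List ℕ → (ℕ → ℕ) → Set
StrictMonoOn w f = ∀ {y z} → y ∈ w → z ∈ w → y < z → f y < f z

strictMonoOn-⊆ : v ⊆ w → StrictMonoOn w f → StrictMonoOn v f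
strictMonoOn-⊆ v⊆w mono y∈v z∈v = mono (v⊆w y∈v) (v⊆w z∈v)

strictMonoOn-⇔ : StrictMonoOn w f → y ∈ w → z ∈ w → (f y < f z ⇔ y < z)
strictMonoOn-⇔ {f = f} {y = y} {z} mono y∈w z∈w = mk⇔ reflect (mono y∈w z∈w)
  where
  reflect : f y < f z → y < z
  reflect fy<fz with <-cmp y z
  ... | tri< y<z _ _  = y<z
  ... | tri≈ _ refl _ = contradiction fy<fz (<-irrefl refl)
  ... | tri> _ _ z<y  = contradiction (mono z∈w y∈w z<y) (<-asym fy<fz)

below-map : StrictMonoOn w f → l ∈ w → below (f l) (map f w) ≡ map f (below l w)
below-map mono l∈w =
  filter-map-local (_<? _) (_<? _) (All.tabulate λ y∈w → strictMonoOn-⇔ mono y∈w l∈w)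

above-map : StrictMonoOn w f → l ∈ w → above (f l) (map f w) ≡ map f (above l w)
above-map mono l∈w =
  filter-map-local (_>? _) (_>? _) (All.tabulate λ y∈w → strictMonoOn-⇔ mono l∈w y∈w)

rank : List ℕ → ℕ → ℕ
rank w x = suc (length (below x w))

length-std : ∀ w → length (std w) ≡ length w
length-std w = length-map (rank w) w

below-shorter : l ∈ w → length (below l w) < length w
below-shorter {l} {w} l∈w = filter-notAll (_<? l) w (Any.map (λ { refl → <-irrefl refl }) l∈w)

above-shorter : l ∈ w → length (above l w) < length w
above-shorter {l} {w} l∈w = filter-notAll (_>? l) w (Any.map (λ { refl → <-irrefl refl }) l∈w)

below-below : ∀ w → x ≤ l → below x (below l w) ≡ below x w
below-below w x≤l = filter-filter-⊆ (_<? _) (_<? _) (λ y<x → <-≤-trans y<x x≤l) w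

rank-below : ∀ w → x ≤ l → rank (below l w) x ≡ rank w x
rank-below w x≤l = cong (suc ∘ length) (below-below w x≤l)

rank-∷-self : ∀ x w → rank (x ∷ w) x ≡ rank w x
rank-∷-self x w = cong (suc ∘ length) (below-∷-≮ {w = w} (<-irrefl refl))

rank-≤ : ∀ w → rank w x ≤ suc (length w)
rank-≤ w = s≤s (length-filter (_<? _) w)

rank-strictMono : StrictMonoOn w (rank w)
rank-strictMono {w} {y} {z} y∈w _ y<z =
  s≤s (subst (λ u → length u < length (below z w)) (below-below w (<⇒≤ y<z))
             (below-shorter (∈-filter⁺ (_<? z) y∈w y<z)))

rank-map : StrictMonoOn w f → z ∈ w → rank (map f w) (f z) ≡ rank w z
rank-map {w} {f} {z} mono z∈w =
  cong suc (trans (cong length (below-map mono z∈w)) (length-map f (below z w)))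

std-map : StrictMonoOn w f → std (map f w) ≡ std w
std-map {w} mono = trans (sym (map-∘ w)) (map-cong-local (All.tabulate (rank-map mono)))

rank-↭ : v ↭ w → rank v x ≡ rank w x
rank-↭ {x = x} v↭w = cong suc (↭-length (filter-↭ (_<? x) v↭w))

below-above-↭ : ∀ w → l ∉ w → w ↭ below l w ++ above l w
below-above-↭ [] _ = ↭-refl
below-above-↭ {l} (y ∷ w) l∉y∷w with <-cmp y l | below-above-↭ w (l∉y∷w ∘ there)
... | tri< y<l _ _ | ih rewrite below-∷-< {w = w} y<l | above-∷-≯ {w = w} (<-asym y<l) = ↭-prep y ih
... | tri≈ _ y≡l _ | _  = contradiction (here (sym y≡l)) l∉y∷w
... | tri> _ _ l<y | ih rewrite below-∷-≮ {w = w} (<-asym l<y) | above-∷-> {w = w} l<y =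
  ↭-trans (↭-prep y ih) (↭-sym (shift y (below l w) (above l w)))

split-↭ : Unique w → l ∈ w → w ↭ below l w ++ l ∷ above l w
split-↭ {l ∷ w} u (here refl)
  rewrite below-∷-≮ {w = w} (<-irrefl {l} refl) | above-∷-≯ {w = w} (<-irrefl {l} refl) =
  ↭-trans (↭-prep l (below-above-↭ w (Unique[x∷xs]⇒x∉xs u)))
          (↭-sym (shift l (below l w) (above l w)))
split-↭ {y ∷ w} {l} (y≢w ∷ u) (there l∈w) with <-cmp y l | split-↭ u l∈w
... | tri< y<l _ _ | ih rewrite below-∷-< {w = w} y<l | above-∷-≯ {w = w} (<-asym y<l) = ↭-prep y ih
... | tri≈ _ y≡l _ | _  = contradiction y≡l (All.lookup y≢w l∈w)
... | tri> _ _ l<y | ih rewrite below-∷-≮ {w = w} (<-asym l<y) | above-∷-> {w = w} l<y =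
  ↭-trans (↭-prep y ih) (↭-trans (↭-sym (shift y (below l w) (l ∷ above l w)))
                                 (++⁺ˡ (below l w) (↭-swap y l ↭-refl)))

length-split : Unique w → l ∈ w → length w ≡ length (below l w) + suc (length (above l w))
length-split {w} {l} u l∈w = trans (↭-length (split-↭ u l∈w)) (length-++ (below l w))

rank-above : Unique w → l ∈ w → l < x → rank w x ≡ rank w l + rank (above l w) x
rank-above {w} {l} {x} u l∈w l<x = cong suc (begin
  length (below x w)
    ≡⟨ ↭-length (filter-↭ (_<? x) (split-↭ u l∈w)) ⟩
  length (below x (below l w ++ l ∷ above l w))
    ≡⟨ cong length (filter-++ (_<? x) (below l w) _) ⟩
  length (below x (below l w) ++ below x (l ∷ above l w))
    ≡⟨ cong₂ (λ b a → length (b ++ a)) below-below-all (below-∷-< l<x) ⟩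
  length (below l w ++ l ∷ below x (above l w))
    ≡⟨ length-++ (below l w) ⟩
  length (below l w) + suc (length (below x (above l w)))  ∎)
  where
  below-below-all : below x (below l w) ≡ below l w
  below-below-all = filter-all (_<? x) (All.map (λ y<l → <-trans y<l l<x) (all-filter (_<? l) w))

◁-left : ∀ L R {i} → i ≤ leaves L → (L ∨ R) ◁ i ≡ (L ◁ i) ∨ R
◁-left L R {i} i≤ with i ≤? leaves L
... | yes _ = refl
... | no i≰ = contradiction i≤ i≰

◁-right : ∀ L R {j} → (L ∨ R) ◁ (leaves L + suc j) ≡ L ∨ (R ◁ suc j)
◁-right L R {j} with leaves L + suc j ≤? leaves L
... | yes i≤ = contradiction i≤ (m+1+n≰m (leaves L))
... | no _   = cong (λ i → L ∨ (R ◁ i)) (m+n∸m≡n (leaves L) (suc j))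

lastOr0-∈ : ∀ x xs → lastOr0 (x ∷ xs) ∈ x ∷ xs
lastOr0-∈ x []       = here refl
lastOr0-∈ x (y ∷ ys) = there (lastOr0-∈ y ys)

lastOr0-map : ∀ f x xs → lastOr0 (map f (x ∷ xs)) ≡ f (lastOr0 (x ∷ xs))
lastOr0-map f x []       = refl
lastOr0-map f x (y ∷ ys) = lastOr0-map f y ys

length-std-< : ∀ v {n} → length v < suc n → length (std v) ≤ n
length-std-< v v< = ≤-trans (≤-reflexive (length-std v)) (≤-pred v<)

φ-aux-fuel : ∀ {j k} w → length w ≤ j → length w ≤ k → φ-aux j w ≡ φ-aux k w
φ-aux-fuel [] _ _ = refl
φ-aux-fuel {suc j} {suc k} (x ∷ xs) (s≤s xs≤j) (s≤s xs≤k) =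
  cong₂ _∨_ (std-side (below-shorter l∈)) (std-side (above-shorter l∈))
  where
  l∈ : lastOr0 (x ∷ xs) ∈ x ∷ xs
  l∈ = lastOr0-∈ x xs
  std-side : length v < suc (length xs) → φ-aux j (std v) ≡ φ-aux k (std v)
  std-side {v} v< =
    φ-aux-fuel (std v) (≤-trans (length-std-< v v<) xs≤j) (≤-trans (length-std-< v v<) xs≤k)

φ-aux-φ : length w ≤ k → φ-aux k w ≡ φ w
φ-aux-φ {w} w≤k = φ-aux-fuel w w≤k ≤-refl

φ-aux-map : ∀ k w → StrictMonoOn w f → φ-aux k (map f w) ≡ φ-aux k w
φ-aux-map k [] _ = refl
φ-aux-map zero (_ ∷ _) _ = refl
φ-aux-map {f} (suc k) (x ∷ xs) mono = begin
  φ-aux k (std (below (lastOr0 fw) fw)) ∨ φ-aux k (std (above (lastOr0 fw) fw))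
    ≡⟨ cong (λ q → φ-aux k (std (below q fw)) ∨ φ-aux k (std (above q fw))) (lastOr0-map f x xs) ⟩
  φ-aux k (std (below (f p) fw)) ∨ φ-aux k (std (above (f p) fw))
    ≡⟨ cong₂ (λ b a → φ-aux k b ∨ φ-aux k a) std-below std-above ⟩
  φ-aux k (std (below p (x ∷ xs))) ∨ φ-aux k (std (above p (x ∷ xs)))  ∎
  where
  fw : List ℕ
  fw = map f (x ∷ xs)
  p : ℕ
  p = lastOr0 (x ∷ xs)
  p∈ : p ∈ x ∷ xs
  p∈ = lastOr0-∈ x xs
  std-below : std (below (f p) fw) ≡ std (below p (x ∷ xs))
  std-below = trans (cong std (below-map mono p∈))
                    (std-map (strictMonoOn-⊆ (filter-⊆ (_<? p) (x ∷ xs)) mono))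
  std-above : std (above (f p) fw) ≡ std (above p (x ∷ xs))
  std-above = trans (cong std (above-map mono p∈))
                    (std-map (strictMonoOn-⊆ (filter-⊆ (_>? p) (x ∷ xs)) mono))

φ-map : StrictMonoOn w f → φ (map f w) ≡ φ w
φ-map {w} {f} mono =
  trans (φ-aux-fuel (map f w) ≤-refl (≤-reflexive (length-map f w))) (φ-aux-map (length w) w mono)

φ-std : ∀ w → φ (std w) ≡ φ w
φ-std w = φ-map {w} rank-strictMono

φ-split : ∀ x xs → φ (x ∷ xs) ≡ φ (below (lastOr0 (x ∷ xs)) (x ∷ xs))
                              ∨ φ (above (lastOr0 (x ∷ xs)) (x ∷ xs))
φ-split x xs = cong₂ _∨_ (std-side (below-shorter l∈)) (std-side (above-shorter l∈))
  where
  l∈ : lastOr0 (x ∷ xs) ∈ x ∷ xs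
  l∈ = lastOr0-∈ x xs
  std-side : length v < suc (length xs) → φ-aux (length xs) (std v) ≡ φ v
  std-side {v} v< = trans (φ-aux-φ (length-std-< v v<)) (φ-std v)

φ-singleton : φ [ x ] ≡ t
φ-singleton {x} = trans (φ-split x [])
  (cong₂ (λ b a → φ b ∨ φ a) (below-∷-≮ {x} {x} {[]} (<-irrefl refl))
                             (above-∷-≯ {x} {x} {[]} (<-irrefl refl)))

Shorter : Rel (List ℕ) 0ℓ
Shorter = _<_ on length

shorter-wellFounded : WellFounded Shorter
shorter-wellFounded = On.wellFounded length <-wellFounded

open WF.All shorter-wellFounded 0ℓ using (wfRec)

leaves-φ : ∀ w → Unique w → leaves (φ w) ≡ suc (length w)
leaves-φ = wfRec LeafCount step
  where
  LeafCount : List ℕ → Set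
  LeafCount w = Unique w → leaves (φ w) ≡ suc (length w)
  step : ∀ w → WfRec Shorter LeafCount w → LeafCount w
  step [] _ _ = refl
  step (x ∷ xs) rec u = begin
    leaves (φ (x ∷ xs))              ≡⟨ cong leaves (φ-split x xs) ⟩
    leaves (φ b) + leaves (φ a)      ≡⟨ cong₂ _+_ (rec (below-shorter p∈) (filter⁺ (_<? p) u))
                                                  (rec (above-shorter p∈) (filter⁺ (_>? p) u)) ⟩
    suc (length b) + suc (length a)  ≡⟨ cong suc (length-split u p∈) ⟨
    suc (length (x ∷ xs))            ∎
    where
    p : ℕ
    p = lastOr0 (x ∷ xs)
    p∈ : p ∈ x ∷ xs
    p∈ = lastOr0-∈ x xs
    b a : List ℕ
    b = below p (x ∷ xs)
    a = above p (x ∷ xs)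

◁-rank-below : Unique w → x < l →
               (φ (below l w) ∨ φ (above l w)) ◁ rank w x
                 ≡ (φ (below l w) ◁ rank (below l w) x) ∨ φ (above l w)
◁-rank-below {w} {x} {l} u x<l =
  trans (◁-left (φ (below l w)) (φ (above l w)) fits)
        (cong (λ i → (φ (below l w) ◁ i) ∨ φ (above l w)) (sym (rank-below w (<⇒≤ x<l))))
  where
  fits : rank w x ≤ leaves (φ (below l w))
  fits = subst₂ _≤_ (rank-below w (<⇒≤ x<l)) (sym (leaves-φ _ (filter⁺ (_<? l) u)))
                    (rank-≤ (below l w))

◁-rank-above : Unique w → l ∈ w → l < x →
               (φ (below l w) ∨ φ (above l w)) ◁ rank w x
                 ≡ φ (below l w) ∨ (φ (above l w) ◁ rank (above l w) x)
◁-rank-above {w} {l} {x} u l∈w l<x =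
  trans (cong ((φ (below l w) ∨ φ (above l w)) ◁_) rank-split)
        (◁-right (φ (below l w)) (φ (above l w)))
  where
  rank-split : rank w x ≡ leaves (φ (below l w)) + rank (above l w) x
  rank-split = trans (rank-above u l∈w l<x)
                     (cong (_+ rank (above l w) x) (sym (leaves-φ _ (filter⁺ (_<? l) u))))

φ-insert : ∀ w {x} → Unique (x ∷ w) → φ (x ∷ w) ≡ φ w ◁ rank w x
φ-insert = wfRec Insertion step
  where
  Insertion : List ℕ → Set
  Insertion w = ∀ {x} → Unique (x ∷ w) → φ (x ∷ w) ≡ φ w ◁ rank w x
  step : ∀ w → WfRec Shorter Insertion w → Insertion w
  step [] _ {x} _ = φ-singleton {x}
  step w@(y ∷ ys) rec {x} u@(_ ∷ uw) = by-cases (<-cmp x p)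
    where
    p : ℕ
    p = lastOr0 w
    p∈ : p ∈ w
    p∈ = lastOr0-∈ y ys
    b a : List ℕ
    b = below p w
    a = above p w
    by-cases : Tri (x < p) (x ≡ p) (p < x) → φ (x ∷ w) ≡ φ w ◁ rank w x
    by-cases (tri< x<p _ _) = begin
      φ (x ∷ w)                                  ≡⟨ φ-split x w ⟩
      φ (below p (x ∷ w)) ∨ φ (above p (x ∷ w))
        ≡⟨ cong₂ (λ b′ a′ → φ b′ ∨ φ a′) x∷b (above-∷-≯ (<-asym x<p)) ⟩
      φ (x ∷ b) ∨ φ a
        ≡⟨ cong (_∨ φ a) (rec (below-shorter p∈) u-x∷b) ⟩
      (φ b ◁ rank b x) ∨ φ a                     ≡⟨ ◁-rank-below uw x<p ⟨
      (φ b ∨ φ a) ◁ rank w x                     ≡⟨ cong (_◁ rank w x) (φ-split y ys) ⟨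
      φ w ◁ rank w x                             ∎
      where
      x∷b : below p (x ∷ w) ≡ x ∷ b
      x∷b = below-∷-< x<p
      u-x∷b : Unique (x ∷ b)
      u-x∷b = subst Unique x∷b (filter⁺ (_<? p) u)
    by-cases (tri≈ _ refl _) = contradiction p∈ (Unique[x∷xs]⇒x∉xs u)
    by-cases (tri> _ _ p<x) = begin
      φ (x ∷ w)                                  ≡⟨ φ-split x w ⟩
      φ (below p (x ∷ w)) ∨ φ (above p (x ∷ w))
        ≡⟨ cong₂ (λ b′ a′ → φ b′ ∨ φ a′) (below-∷-≮ (<-asym p<x)) x∷a ⟩
      φ b ∨ φ (x ∷ a)
        ≡⟨ cong (φ b ∨_) (rec (above-shorter p∈) u-x∷a) ⟩
      φ b ∨ (φ a ◁ rank a x)                     ≡⟨ ◁-rank-above uw p∈ p<x ⟨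
      (φ b ∨ φ a) ◁ rank w x                     ≡⟨ cong (_◁ rank w x) (φ-split y ys) ⟨
      φ w ◁ rank w x                             ∎
      where
      x∷a : above p (x ∷ w) ≡ x ∷ a
      x∷a = above-∷-> p<x
      u-x∷a : Unique (x ∷ a)
      u-x∷a = subst Unique x∷a (filter⁺ (_>? p) u)

φ̂-cons : ∀ x y ys → φ̂ (x ∷ y ∷ ys) ≡ φ̂ (std (y ∷ ys)) ◁ x
φ̂-cons x y ys = cong (λ n → φ̂-aux n (std (y ∷ ys)) ◁ x) (sym (length-std (y ∷ ys)))

φ̂-std : ∀ w → Unique w → φ̂ (std w) ≡ φ w
φ̂-std [] _ = refl
φ̂-std (x ∷ []) u = sym (φ-insert [] u)
φ̂-std (x ∷ v@(y ∷ ys)) u@(_ ∷ uv) = begin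
  φ̂ (std (x ∷ v))
    ≡⟨ φ̂-cons (rank (x ∷ v) x) (rank (x ∷ v) y) (map (rank (x ∷ v)) ys) ⟩
  φ̂ (std (map (rank (x ∷ v)) v)) ◁ rank (x ∷ v) x
    ≡⟨ cong₂ _◁_ (cong φ̂ (std-map rank-on-v)) (rank-∷-self x v) ⟩
  φ̂ (std v) ◁ rank v x
    ≡⟨ cong (_◁ rank v x) (φ̂-std v uv) ⟩
  φ v ◁ rank v x
    ≡⟨ φ-insert v u ⟨
  φ (x ∷ v)  ∎
  where
  rank-on-v : StrictMonoOn v (rank (x ∷ v))
  rank-on-v = strictMonoOn-⊆ (xs⊆x∷xs v x) rank-strictMono

below-upTo : ∀ {m} n → m ≤ n → below m (upTo n) ≡ upTo m
below-upTo {m} n m≤n with m ≟ n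
... | yes refl = filter-all (_<? m) (All.tabulate ∈-upTo⁻)
below-upTo {m} (suc n) m≤1+n | no m≢1+n = begin
  below m (upTo (suc n))             ≡⟨ cong (below m) (upTo-∷ʳ n) ⟨
  below m (upTo n ++ [ n ])          ≡⟨ filter-++ (_<? m) (upTo n) [ n ] ⟩
  below m (upTo n) ++ below m [ n ]  ≡⟨ cong₂ _++_ (below-upTo n m≤n) (below-∷-≮ (≤⇒≯ m≤n)) ⟩
  upTo m ++ []                       ≡⟨ ++-identityʳ (upTo m) ⟩
  upTo m                             ∎
  where
  m≤n : m ≤ n
  m≤n = ≤-pred (≤∧≢⇒< m≤1+n m≢1+n)
below-upTo {zero} zero z≤n | no 0≢0 = contradiction refl 0≢0

rank-oneTo : ∀ n → z ∈ oneTo n → rank (oneTo n) z ≡ z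
rank-oneTo n z∈ with ∈-map⁻ suc z∈
... | m , m∈ , refl = begin
  rank (map suc (upTo n)) (suc m)  ≡⟨ rank-map (λ _ _ → s≤s) m∈ ⟩
  suc (length (below m (upTo n)))  ≡⟨ cong (suc ∘ length) (below-upTo n (<⇒≤ (∈-upTo⁻ m∈))) ⟩
  suc (length (upTo m))            ≡⟨ cong suc (length-upTo m) ⟩
  suc m                            ∎

std-perm : ∀ {n π} → IsPerm n π → std π ≡ π
std-perm {n} π↭ =
  map-id-local (All.tabulate λ z∈π → trans (rank-↭ π↭) (rank-oneTo n (∈-resp-↭ π↭ z∈π)))

unique-perm : ∀ {n π} → IsPerm n π → Unique π
unique-perm {n} π↭ = Unique-resp-↭ (↭⇒↭ₛ (↭-sym π↭)) (map⁺ suc-injective (upTo⁺ n))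

theorem4p8 : (n : ℕ) (π : List ℕ) → IsPerm n π → φ̂ π ≡ φ π
theorem4p8 n π π↭ = begin
  φ̂ π        ≡⟨ cong φ̂ (std-perm π↭) ⟨
  φ̂ (std π)  ≡⟨ φ̂-std π (unique-perm π↭) ⟩
  φ π        ∎
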